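{- Let $G=(V,E)$ be a graph with $m$ edges, let $\lambda$ be such that $G$ and all graphs obtained from it during the subsequent updates have arboricity at most $\lambda$, let $T=\sqrt{m\log m\cdot\lambda}$, $V_{high}^*=\{v\in V\mid \deg_G(v)\ge 20T\}$ and $A^*=N_G(V_{high}^*)\setminus V_{high}^*$, and let $candidate^*(v)$ for $v\in V_{high}^*$ be defined on $G$ by the following procedure: set $K_1=V_{high}^*$; for $i=1,\dots,\lceil\log m\rceil$: for $u\in A^*$ let $\mathrm{unitcost}_i(u)=\frac{\deg_G(u)}{|N_G(u)\cap K_i|}$; for $v\in K_i$ let $S_i(v)$ be the multiset $\{\mathrm{unitcost}_i(u)\mid u\in N_G(v)\cap A^*\}$ and $p(v)$ a median of $S_i(v)$; let $L_i=\{v\in K_i\mid p(v)\le\frac{m}{|K_i|\cdot T}\}$, set $candidate^*(v)=\{u\in N_G(v)\cap A^*\mid \mathrm{unitcost}_i(u)\le p(v)\}$ for $v\in L_i$, and let $K_{i+1}=K_i\setminus L_i$. Suppose $G$ then undergoes $t\le T$ edge updates (insertions or deletions), resulting in graph $G_t$. Then for every injective map $f:V_{high}^*\to V$ with $f(v)\in candidate^*(v)$ for all $v$, we have $\sum_{v\in V_{high}^*}\deg_{G_t}(f(v))\le 4T$.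
   Context: $N_G(v)$ is the neighbor set of $v$ in $G$, $N_G(S)=\bigcup_{v\in S}N_G(v)$, and $\deg_G(v)=|N_G(v)|$. The arboricity of a graph is $\max_{U,|U|\ge2}\lceil |E(U)|/(|U|-1)\rceil$ over vertex subsets $U$, where $E(U)$ is the set of edges induced by $U$. (Every vertex of $V_{high}^*$ lies in some $L_i$, so $candidate^*$ is defined on all of $V_{high}^*$.) -}

module Defs where

open import Data.Nat using (ℕ; zero; suc; _+_; _*_; _∸_; _^_; _≤_; _<_; _≤ᵇ_)
open import Data.Nat.DivMod using (_/_)
open import Data.Nat.Logarithm using (⌈log₂_⌉)
open import Data.Bool using (Bool; true; false; not; _∧_; _∨_; if_then_else_)
open import Data.Fin using (Fin; toℕ)
import Data.Fin as Fin
open import Data.Integer using (+_)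
import Data.Integer as ℤ
open import Data.Rational using (ℚ; 0ℚ; ↥_; ↧ₙ_)
import Data.Rational as ℚ
open import Data.Product using (Σ; _×_; ∃)
open import Data.Sum using (_⊎_)
open import Relation.Nullary using (¬_)
open import Relation.Binary.PropositionalEquality using (_≡_; _≢_)

sumF : ∀ {n} → (Fin n → ℕ) → ℕ
sumF {zero}  f = 0
sumF {suc n} f = f Fin.zero + sumF (λ i → f (Fin.suc i))

count : ∀ {n} → (Fin n → Bool) → ℕ
count f = sumF (λ i → if f i then 1 else 0)

anyF : ∀ {n} → (Fin n → Bool) → Bool
anyF {zero}  f = false
anyF {suc n} f = f Fin.zero ∨ anyF (λ i → f (Fin.suc i))

record Graph (n : ℕ) : Set where
  field
    adj    : Fin n → Fin n → Bool
    sym    : ∀ u v → adj u v ≡ adj v u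
    irrefl : ∀ v → adj v v ≡ false
open Graph public

deg : ∀ {n} → Graph n → Fin n → ℕ
deg G v = count (adj G v)

-- |E(U)| : number of edges induced by U (each unordered pair counted once)
edgesIn : ∀ {n} → Graph n → (Fin n → Bool) → ℕ
edgesIn G U = sumF λ u → count λ v →
  U u ∧ U v ∧ adj G u v ∧ (suc (toℕ u) ≤ᵇ toℕ v)

edges : ∀ {n} → Graph n → ℕ
edges G = edgesIn G (λ _ → true)

-- ceiling division ⌈a / b⌉ (b > 0; value for b = 0 irrelevant)
ceilDiv : ℕ → ℕ → ℕ
ceilDiv a zero    = 0
ceilDiv a (suc b) = (a + b) / suc b

ArboricityAtMost : ∀ {n} → Graph n → ℕ → Set
ArboricityAtMost {n} G lam =
  ∀ (U : Fin n → Bool) → 2 ≤ count U → ceilDiv (edgesIn G U) (count U ∸ 1) ≤ lam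

-- H is obtained from G by a single edge insertion or deletion:
-- exactly the adjacency of one pair {a , b} (a ≠ b) is flipped.
SameUnorderedPair : ∀ {n} → Fin n → Fin n → Fin n → Fin n → Set
SameUnorderedPair x y a b = (x ≡ a × y ≡ b) ⊎ (x ≡ b × y ≡ a)

OneEdgeUpdate : ∀ {n} → Graph n → Graph n → Set
OneEdgeUpdate {n} G H = Σ (Fin n) λ a → Σ (Fin n) λ b →
    a ≢ b
  × adj H a b ≡ not (adj G a b)
  × (∀ x y → ¬ SameUnorderedPair x y a b → adj H x y ≡ adj G x y)

-- Comparisons with T = sqrt(m · log₂ m · λ), done exactly in ℕ.
-- For m ≥ 1 and naturals x, y :  x · log₂ m ≤ y  ⇔  m ^ x ≤ 2 ^ y.

module Threshold (m lam : ℕ) where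

  -- 20·T ≤ d   ⇔  400·m·λ·log₂ m ≤ d²
  twentyT≤ᵇ : ℕ → Bool
  twentyT≤ᵇ d = m ^ (400 * m * lam) ≤ᵇ 2 ^ (d * d)

  -- x ≤ c·T  (x, c naturals)  ⇔  x² ≤ c²·m·λ·log₂ m
  _≤_·T : ℕ → ℕ → Set
  x ≤ c ·T = 2 ^ (x * x) ≤ m ^ (c * c * m * lam)

  -- p ≤ m / (k · T)  for p ∈ ℚ, k ∈ ℕ  (read as p·k·T ≤ m; true when k·T = 0).
  -- If p = a/b > 0 this is  a²k²·m·λ·log₂ m ≤ b²m².
  ≤m/[_·T]ᵇ : ℚ → ℕ → Bool
  ≤m/[ p ·T]ᵇ k =
    (p ℚ.≤ᵇ 0ℚ) ∨ (m ^ (a * a * k * k * m * lam) ≤ᵇ 2 ^ (b * b * m * m))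
    where
      a = ℤ.∣ ↥ p ∣
      b = ↧ₙ p

-- The candidate* procedure on G, parametrised by a choice of medians
-- med i v  (round i = 0,1,…,⌈log₂ m⌉-1 corresponds to the paper's i = 1,…,⌈log m⌉).

-- the rational d / c  (only used with c > 0; value for c = 0 irrelevant)
frac : ℕ → ℕ → ℚ
frac d zero    = 0ℚ
frac d (suc c) = (+ d) ℚ./ suc c

module Procedure {n : ℕ} (G : Graph n) (lam : ℕ) (med : ℕ → Fin n → ℚ) where

  m : ℕ
  m = edges G

  open Threshold m lam public

  rounds : ℕ
  rounds = ⌈log₂ m ⌉

  Vhigh : Fin n → Bool
  Vhigh v = twentyT≤ᵇ (deg G v)

  Astar : Fin n → Bool
  Astar u = not (Vhigh u) ∧ anyF (λ v → adj G u v ∧ Vhigh v)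

  mutual
    -- K i = paper's K_{i+1}
    K : ℕ → Fin n → Bool
    K zero    = Vhigh
    K (suc i) v = K i v ∧ not (L i v)

    unitcost : ℕ → Fin n → ℚ
    unitcost i u = frac (deg G u) (count (λ w → adj G u w ∧ K i w))

    L : ℕ → Fin n → Bool
    L i v = K i v ∧ ≤m/[ med i v ·T]ᵇ (count (K i))

  -- S_i(v) = multiset { unitcost_i(u) | u ∈ N_G(v) ∩ A* } ; p is a median of it:
  -- at least half of the elements are ≤ p and at least half are ≥ p.
  IsMedianOfS : ℕ → Fin n → ℚ → Set
  IsMedianOfS i v p =
      count (λ u → adj G v u ∧ Astar u) ≤ 2 * count (λ u → adj G v u ∧ Astar u ∧ (unitcost i u ℚ.≤ᵇ p))
    × count (λ u → adj G v u ∧ Astar u) ≤ 2 * count (λ u → adj G v u ∧ Astar u ∧ (p ℚ.≤ᵇ unitcost i u))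

  Candidate : Fin n → Fin n → Set
  Candidate v u = Σ ℕ λ i →
      i < rounds
    × L i v ≡ true
    × adj G v u ≡ true
    × Astar u ≡ true
    × unitcost i u ℚ.≤ med i v

{-# OPTIONS --safe #-}
-- Write T² = mλ·log m and N = mλ⌊log₂ m⌋; all comparisons with T are made on squares
-- (x ·√ N ≤ y means x²N ≤ y²). For v ∈ L_i its candidate u = f(v) satisfies
-- deg(u)/|N_G(u) ∩ K_i| ≤ p(v) ≤ m/(|K_i| T), i.e. |K_i| deg(u) T ≤ m |N_G(u) ∩ K_i|. Summed over
-- L_i, injectivity of f turns the right-hand side into m times the number of edges between
-- f(L_i) ⊆ A* and K_i ⊆ V*_high, which arboricity bounds by λ(|L_i| + |K_i|); so round i
-- contributes at most (3 + h_i) mλ/(2T), where h_i = 1 iff L_i holds more than half of K_i.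
-- Such a round at least halves 2|K_i| + 1, and |K_1| ≤ 2m/(20T) because high vertices have
-- degree ≥ 20T, so Σ h_i + 5 ≤ ⌊log₂ m⌋ and the ⌈log₂ m⌉ rounds give Σ deg_G(f(v)) ≤ 2T.
-- An edge update raises the degree of two vertices by at most one, and each of them is f(v)
-- for at most one v, so the t ≤ T updates add at most 2T.
module Submission where

open import Defs hiding (sym)
open import Data.Bool using (Bool; true; false; T; not; _∧_; _∨_; if_then_else_)
open import Data.Bool.Properties using (∧-zeroʳ; T-≡)
open import Data.Fin using (Fin; zero; suc; toℕ; fromℕ<)
open import Data.Fin.Properties using (suc-injective; toℕ-injective; toℕ-fromℕ<; _≟_)
open import Data.Integer as ℤ using (-[1+_]; ∣_∣)
import Data.Integer.Properties as ℤP
open import Data.Integer.GCD using (gcd)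
open import Data.List using ([]; _∷_)
open import Data.Nat as ℕ
  using (ℕ; zero; suc; _+_; _*_; _∸_; _^_; _≤_; _<_; _≤′_; ≤′-refl; ≤′-step; _≤ᵇ_; _<ᵇ_; _≤?_; _<?_;
         z≤n; s≤s; NonZero; ≢-nonZero; >-nonZero)
open import Data.Nat.DivMod using (_/_; m*n/n≡m; /-monoˡ-≤)
open import Data.Nat.Logarithm using (⌈log₂_⌉; ⌈log₂⌉-mono-≤; ⌈log₂2^n⌉≡n)
open import Data.Nat.Properties hiding (suc-injective; _≟_)
open import Data.Nat.Tactic.RingSolver using (solve-∀; solve)
open import Data.Product using (∃; _,_; _×_; proj₁; proj₂)
open import Data.Rational as ℚ using (ℚ; ↥_; ↧_; ↧ₙ_; 0ℚ)
import Data.Rational.Properties as ℚP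
open import Data.Sum using (inj₁; inj₂)
open import Function using (_∘_; Equivalence)
open import Relation.Binary.Definitions using (tri<; tri≈; tri>)
open import Relation.Binary.PropositionalEquality
open import Relation.Nullary using (¬_; Dec; yes; no; does; contradiction)
open import Relation.Nullary.Reflects using (ofʸ; ofⁿ)
open import Algebra.Properties.Semiring.Sum +-*-semiring using (sum; ∑-distrib-+; ∑-comm; *-distribˡ-sum)
open import Algebra.Properties.CommutativeSemigroup ℤP.*-commutativeSemigroup using (xy∙z≈xz∙y)

𝟙 : Bool → ℕ
𝟙 b = if b then 1 else 0

𝟙≤1 : ∀ b → 𝟙 b ≤ 1
𝟙≤1 true  = ≤-refl
𝟙≤1 false = z≤n

*-𝟙 : ∀ c b → c * 𝟙 b ≡ (if b then c else 0)
*-𝟙 c true  = *-identityʳ c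
*-𝟙 c false = *-zeroʳ c

∧-true⁻ : ∀ {a b} → a ∧ b ≡ true → a ≡ true × b ≡ true
∧-true⁻ {true} b≡true = refl , b≡true

𝟙-mono : ∀ {a b} → (a ≡ true → b ≡ true) → 𝟙 a ≤ 𝟙 b
𝟙-mono {false}     _   = z≤n
𝟙-mono {true}  {b} a⇒b rewrite a⇒b refl = ≤-refl

sumF≡sum : ∀ {n} (f : Fin n → ℕ) → sumF f ≡ sum f
sumF≡sum {zero}  f = refl
sumF≡sum {suc n} f = cong (f zero +_) (sumF≡sum (f ∘ suc))

sumF-cong : ∀ {n} {f g : Fin n → ℕ} → (∀ i → f i ≡ g i) → sumF f ≡ sumF g
sumF-cong {zero}  f≗g = refl
sumF-cong {suc n} f≗g = cong₂ _+_ (f≗g zero) (sumF-cong (f≗g ∘ suc))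

sumF-mono : ∀ {n} {f g : Fin n → ℕ} → (∀ i → f i ≤ g i) → sumF f ≤ sumF g
sumF-mono {zero}  f≤g = z≤n
sumF-mono {suc n} f≤g = +-mono-≤ (f≤g zero) (sumF-mono (f≤g ∘ suc))

sumF-zero : ∀ {n} {f : Fin n → ℕ} → (∀ i → f i ≡ 0) → sumF f ≡ 0
sumF-zero {zero}  f≗0 = refl
sumF-zero {suc n} f≗0 rewrite f≗0 zero = sumF-zero (f≗0 ∘ suc)

sumF-const : ∀ n c → sumF {n} (λ _ → c) ≡ n * c
sumF-const zero    c = refl
sumF-const (suc n) c = cong (c +_) (sumF-const n c)

sumF-+ : ∀ {n} (f g : Fin n → ℕ) → sumF (λ i → f i + g i) ≡ sumF f + sumF g
sumF-+ f g = begin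
  sumF (λ i → f i + g i)  ≡⟨ sumF≡sum (λ i → f i + g i) ⟩
  sum (λ i → f i + g i)   ≡⟨ ∑-distrib-+ f g ⟩
  sum f + sum g           ≡⟨ sym (cong₂ _+_ (sumF≡sum f) (sumF≡sum g)) ⟩
  sumF f + sumF g         ∎
  where open ≡-Reasoning

sumF-*ˡ : ∀ {n} c (f : Fin n → ℕ) → sumF (λ i → c * f i) ≡ c * sumF f
sumF-*ˡ c f = begin
  sumF (λ i → c * f i)  ≡⟨ sumF≡sum (λ i → c * f i) ⟩
  sum (λ i → c * f i)   ≡⟨ sym (*-distribˡ-sum c f) ⟩
  c * sum f             ≡⟨ cong (c *_) (sym (sumF≡sum f)) ⟩
  c * sumF f            ∎
  where open ≡-Reasoning

sumF-comm : ∀ {m n} (f : Fin m → Fin n → ℕ) →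
  sumF (λ i → sumF (f i)) ≡ sumF (λ j → sumF (λ i → f i j))
sumF-comm f = begin
  sumF (λ i → sumF (f i))            ≡⟨ sumF-cong (λ i → sumF≡sum (f i)) ⟩
  sumF (λ i → sum (f i))             ≡⟨ sumF≡sum (λ i → sum (f i)) ⟩
  sum (λ i → sum (f i))              ≡⟨ ∑-comm f ⟩
  sum (λ j → sum (λ i → f i j))      ≡⟨ sym (sumF≡sum (λ j → sum (λ i → f i j))) ⟩
  sumF (λ j → sum (λ i → f i j))     ≡⟨ sumF-cong (λ j → sym (sumF≡sum (λ i → f i j))) ⟩
  sumF (λ j → sumF (λ i → f i j))    ∎
  where open ≡-Reasoning

count-∧ˡ : ∀ {n} b (P : Fin n → Bool) → count (λ i → b ∧ P i) ≡ (if b then count P else 0)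
count-∧ˡ     true  P = refl
count-∧ˡ {n} false P = sumF-zero {n} (λ _ → refl)

sumF-if-const : ∀ {n} (P : Fin n → Bool) c → sumF (λ i → if P i then c else 0) ≡ c * count P
sumF-if-const P c = trans (sumF-cong (λ i → sym (*-𝟙 c (P i)))) (sumF-*ˡ c (𝟙 ∘ P))

term≤sumF : ∀ {n} (f : Fin n → ℕ) j → f j ≤ sumF f
term≤sumF f zero    = m≤m+n (f zero) _
term≤sumF f (suc j) = ≤-trans (term≤sumF (f ∘ suc) j) (m≤n+m _ (f zero))

count-mono : ∀ {n} {P Q : Fin n → Bool} → (∀ i → P i ≡ true → Q i ≡ true) → count P ≤ count Q
count-mono P⇒Q = sumF-mono (λ i → 𝟙-mono (P⇒Q i))

count-pos : ∀ {n} (P : Fin n → Bool) i → P i ≡ true → 1 ≤ count P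
count-pos P i Pi = subst (λ b → 𝟙 b ≤ count P) Pi (term≤sumF (𝟙 ∘ P) i)

count≡0⇒false : ∀ {n} (P : Fin n → Bool) → count P ≡ 0 → ∀ i → P i ≡ false
count≡0⇒false P #P≡0 i with P i in Pi
... | false = refl
... | true  = contradiction (subst (1 ≤_) #P≡0 (count-pos P i Pi)) λ ()

count-∨ : ∀ {n} (P Q : Fin n → Bool) → count (λ i → P i ∨ Q i) ≤ count P + count Q
count-∨ P Q = ≤-trans (sumF-mono (λ i → 𝟙-∨ (P i) (Q i))) (≤-reflexive (sumF-+ (𝟙 ∘ P) (𝟙 ∘ Q)))
  where
  𝟙-∨ : ∀ a b → 𝟙 (a ∨ b) ≤ 𝟙 a + 𝟙 b
  𝟙-∨ true  b = s≤s z≤n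
  𝟙-∨ false b = ≤-refl

count-remove : ∀ {n} (P Q : Fin n → Bool) → (∀ i → Q i ≡ true → P i ≡ true) →
  count P ≡ count (λ i → P i ∧ not (Q i)) + count Q
count-remove P Q Q⇒P = trans (sumF-cong (λ i → 𝟙-remove (P i) (Q i) (Q⇒P i)))
                             (sumF-+ (λ i → 𝟙 (P i ∧ not (Q i))) (𝟙 ∘ Q))
  where
  𝟙-remove : ∀ a b → (b ≡ true → a ≡ true) → 𝟙 a ≡ 𝟙 (a ∧ not b) + 𝟙 b
  𝟙-remove true  true  _   = refl
  𝟙-remove true  false _   = refl
  𝟙-remove false false _   = refl
  𝟙-remove false true  b⇒a = contradiction (b⇒a refl) λ ()

count≤1 : ∀ {n} (P : Fin n → Bool) → (∀ v w → P v ≡ true → P w ≡ true → v ≡ w) → count P ≤ 1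
count≤1 {zero}  P unique = z≤n
count≤1 {suc n} P unique with P zero in P0
... | true  = ≤-reflexive (cong suc (sumF-zero rest≡0))
  where
  rest≡0 : ∀ i → 𝟙 (P (suc i)) ≡ 0
  rest≡0 i with P (suc i) in Psi
  ... | false = refl
  ... | true  = contradiction (unique zero (suc i) P0 Psi) λ ()
... | false = count≤1 (P ∘ suc) (λ v w Pv Pw → suc-injective (unique (suc v) (suc w) Pv Pw))

count-agreeExcept : ∀ {n} (P Q : Fin n → Bool) b → (∀ y → y ≢ b → P y ≡ Q y) →
  count P ≤ suc (count Q)
count-agreeExcept P Q zero agree = begin
  𝟙 (P zero) + count (P ∘ suc)  ≤⟨ +-monoˡ-≤ _ (𝟙≤1 (P zero)) ⟩
  suc (count (P ∘ suc))         ≡⟨ cong suc (sumF-cong (λ y → cong 𝟙 (agree (suc y) λ ()))) ⟩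
  suc (count (Q ∘ suc))         ≤⟨ s≤s (m≤n+m _ (𝟙 (Q zero))) ⟩
  suc (count Q)                 ∎
  where open ≤-Reasoning
count-agreeExcept P Q (suc b) agree = begin
  𝟙 (P zero) + count (P ∘ suc)        ≡⟨ cong (λ a → 𝟙 a + count (P ∘ suc)) (agree zero λ ()) ⟩
  𝟙 (Q zero) + count (P ∘ suc)        ≤⟨ +-monoʳ-≤ (𝟙 (Q zero)) (count-agreeExcept (P ∘ suc) (Q ∘ suc) b
                                           (λ y y≢b → agree (suc y) (y≢b ∘ suc-injective))) ⟩
  𝟙 (Q zero) + suc (count (Q ∘ suc))  ≡⟨ +-suc _ _ ⟩
  suc (count Q)                       ∎
  where open ≤-Reasoning

anyF-intro : ∀ {n} (h : Fin n → Bool) i → h i ≡ true → anyF h ≡ true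
anyF-intro h zero    hi rewrite hi = refl
anyF-intro h (suc i) hi with h zero
... | true  = refl
... | false = anyF-intro (h ∘ suc) i hi

anyF-witness : ∀ {n} (h : Fin n → Bool) → anyF h ≡ true → ∃ λ i → h i ≡ true
anyF-witness {suc n} h any-h with h zero in h0
... | true  = zero , h0
... | false with anyF-witness (h ∘ suc) any-h
...   | i , hi = suc i , hi

𝟙-anyF≤count : ∀ {n} (h : Fin n → Bool) → 𝟙 (anyF h) ≤ count h
𝟙-anyF≤count h with anyF h in any-h
... | false = z≤n
... | true  with anyF-witness h any-h
...   | i , hi = count-pos h i hi

count≤𝟙-anyF : ∀ {n} (h : Fin n → Bool) → count h ≤ 1 → count h ≤ 𝟙 (anyF h)
count≤𝟙-anyF h #h≤1 with anyF h in any-h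
... | true  = #h≤1
... | false = ≤-reflexive (sumF-zero h≡false)
  where
  h≡false : ∀ i → 𝟙 (h i) ≡ 0
  h≡false i with h i in hi
  ... | false = refl
  ... | true  = contradiction (trans (sym (anyF-intro h i hi)) any-h) λ ()

≤ᵇ-true⇒≤ : ∀ {a b} → (a ≤ᵇ b) ≡ true → a ≤ b
≤ᵇ-true⇒≤ {a} {b} a≤ᵇb = ≤ᵇ⇒≤ a b (Equivalence.from T-≡ a≤ᵇb)

𝟙-order : ∀ {a b} → a ≢ b → 𝟙 (suc a ≤ᵇ b) + 𝟙 (suc b ≤ᵇ a) ≡ 1
𝟙-order {a} {b} a≢b
  with suc a ≤ᵇ b | ≤ᵇ-reflects-≤ (suc a) b | suc b ≤ᵇ a | ≤ᵇ-reflects-≤ (suc b) a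
... | true  | ofʸ a<b | true  | ofʸ b<a = contradiction b<a (<-asym a<b)
... | true  | _       | false | _       = refl
... | false | _       | true  | _       = refl
... | false | ofⁿ a≮b | false | ofⁿ b≮a = contradiction (≤-antisym (≮⇒≥ b≮a) (≮⇒≥ a≮b)) a≢b

ceilDiv≤⇒≤* : ∀ e b lam → ceilDiv e (suc b) ≤ lam → e ≤ lam * suc b
ceilDiv≤⇒≤* e b lam ⌈e/b+1⌉≤lam with e ≤? lam * suc b
... | yes e≤ = e≤
... | no  e≰ = contradiction ⌈e/b+1⌉≤lam (<⇒≱ (begin-strict
  lam                          <⟨ n<1+n lam ⟩
  suc lam                      ≡⟨ sym (m*n/n≡m (suc lam) (suc b)) ⟩
  suc lam * suc b / suc b      ≤⟨ /-monoˡ-≤ (suc b) [1+lam]*[1+b]≤e+b ⟩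
  (e + b) / suc b              ∎))
  where
  open ≤-Reasoning
  [1+lam]*[1+b]≤e+b : suc lam * suc b ≤ e + b
  [1+lam]*[1+b]≤e+b = begin
    suc b + lam * suc b    ≡⟨ cong suc (+-comm b _) ⟩
    suc (lam * suc b) + b  ≤⟨ +-monoˡ-≤ b (≰⇒> e≰) ⟩
    e + b                  ∎

∧-swap-ends : ∀ a c b → a ∧ c ∧ b ≡ b ∧ c ∧ a
∧-swap-ends true  c true  = refl
∧-swap-ends true  c false = ∧-zeroʳ c
∧-swap-ends false c true  = sym (∧-zeroʳ c)
∧-swap-ends false c false = refl

module _ {n} (G : Graph n) where

  adj⇒≢ : ∀ {u w} → adj G u w ≡ true → u ≢ w
  adj⇒≢ {u} uw refl = contradiction (trans (sym uw) (irrefl G u)) λ ()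

  orderedEdge : (Fin n → Bool) → Fin n → Fin n → Bool
  orderedEdge U u w = U u ∧ U w ∧ adj G u w ∧ (suc (toℕ u) ≤ᵇ toℕ w)

  𝟙-adjacent≡ordered : ∀ U u w →
    𝟙 (U u ∧ U w ∧ adj G u w) ≡ 𝟙 (orderedEdge U u w) + 𝟙 (orderedEdge U w u)
  𝟙-adjacent≡ordered U u w rewrite Graph.sym G w u with U u | U w | adj G u w in uw
  ... | false | false | _     = refl
  ... | false | true  | _     = refl
  ... | true  | false | _     = refl
  ... | true  | true  | false = refl
  ... | true  | true  | true  = sym (𝟙-order (adj⇒≢ uw ∘ toℕ-injective))

  handshake : ∀ U → sumF (λ u → count (λ w → U u ∧ U w ∧ adj G u w)) ≡ 2 * edgesIn G U
  handshake U = begin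
    sumF (λ u → count (λ w → U u ∧ U w ∧ adj G u w))
      ≡⟨ sumF-cong (λ u → trans (sumF-cong (𝟙-adjacent≡ordered U u))
                                (sumF-+ (𝟙 ∘ orderedEdge U u) (λ w → 𝟙 (orderedEdge U w u)))) ⟩
    sumF (λ u → count (orderedEdge U u) + sumF (λ w → 𝟙 (orderedEdge U w u)))
      ≡⟨ sumF-+ (count ∘ orderedEdge U) (λ u → sumF (λ w → 𝟙 (orderedEdge U w u))) ⟩
    edgesIn G U + sumF (λ u → sumF (λ w → 𝟙 (orderedEdge U w u)))
      ≡⟨ cong (edgesIn G U +_) (sym (sumF-comm (λ w u → 𝟙 (orderedEdge U w u)))) ⟩
    edgesIn G U + edgesIn G U
      ≡⟨ cong (edgesIn G U +_) (sym (+-identityʳ _)) ⟩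
    2 * edgesIn G U
      ∎
    where open ≡-Reasoning

  sum-deg≡2*edges : sumF (deg G) ≡ 2 * edges G
  sum-deg≡2*edges = handshake (λ _ → true)

  crossEdges≤edgesIn : ∀ (A B : Fin n → Bool) → (∀ u → A u ≡ true → B u ≡ false) →
    sumF (λ u → if A u then count (λ w → adj G u w ∧ B w) else 0) ≤ edgesIn G (λ x → A x ∨ B x)
  crossEdges≤edgesIn A B disjoint = *-cancelˡ-≤ 2 (begin
    2 * sumF (λ u → if A u then count (λ w → adj G u w ∧ B w) else 0)
                           ≡⟨ cong (2 *_) (sumF-cong (λ u → sym (count-∧ˡ (A u) (λ w → adj G u w ∧ B w)))) ⟩
    2 * X                  ≡⟨ cong (X +_) (trans (+-identityʳ X) X≡X′) ⟩
    X + X′                 ≡⟨ sym (sumF-+ (λ u → count (λ w → A u ∧ adj G u w ∧ B w))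
                                           (λ u → count (λ w → B u ∧ adj G u w ∧ A w))) ⟩
    sumF (λ u → count (λ w → A u ∧ adj G u w ∧ B w) + count (λ w → B u ∧ adj G u w ∧ A w))
                           ≡⟨ sumF-cong (λ u → sym (sumF-+ (λ w → 𝟙 (A u ∧ adj G u w ∧ B w))
                                                           (λ w → 𝟙 (B u ∧ adj G u w ∧ A w)))) ⟩
    sumF (λ u → sumF (λ w → 𝟙 (A u ∧ adj G u w ∧ B w) + 𝟙 (B u ∧ adj G u w ∧ A w)))
                           ≤⟨ sumF-mono (λ u → sumF-mono (λ w →
                                𝟙-cross (A u) (B u) (adj G u w) (A w) (B w) (disjoint u))) ⟩
    sumF (λ u → count (λ w → U u ∧ U w ∧ adj G u w))
                           ≡⟨ handshake U ⟩
    2 * edgesIn G U        ∎)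
    where
    open ≤-Reasoning
    U : Fin n → Bool
    U x = A x ∨ B x
    X X′ : ℕ
    X  = sumF (λ u → count (λ w → A u ∧ adj G u w ∧ B w))
    X′ = sumF (λ u → count (λ w → B u ∧ adj G u w ∧ A w))
    X≡X′ : X ≡ X′
    X≡X′ = begin-equality
      X  ≡⟨ sumF-comm (λ u w → 𝟙 (A u ∧ adj G u w ∧ B w)) ⟩
      sumF (λ w → count (λ u → A u ∧ adj G u w ∧ B w))
         ≡⟨ sumF-cong (λ w → sumF-cong (λ u → cong 𝟙 (swap u w))) ⟩
      X′ ∎
      where
      swap : ∀ u w → A u ∧ adj G u w ∧ B w ≡ B w ∧ adj G w u ∧ A u
      swap u w rewrite Graph.sym G u w = ∧-swap-ends (A u) (adj G w u) (B w)
    𝟙-cross : ∀ a₁ b₁ c a₂ b₂ → (a₁ ≡ true → b₁ ≡ false) →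
      𝟙 (a₁ ∧ c ∧ b₂) + 𝟙 (b₁ ∧ c ∧ a₂) ≤ 𝟙 ((a₁ ∨ b₁) ∧ (a₂ ∨ b₂) ∧ c)
    𝟙-cross true  true  _     _     _     a⇒¬b = contradiction (a⇒¬b refl) λ ()
    𝟙-cross true  false false _     _     _    = z≤n
    𝟙-cross true  false true  true  b₂    _    = ≤-trans (≤-reflexive (+-identityʳ _)) (𝟙≤1 b₂)
    𝟙-cross true  false true  false true  _    = ≤-refl
    𝟙-cross true  false true  false false _    = z≤n
    𝟙-cross false true  false _     _     _    = z≤n
    𝟙-cross false true  true  true  _     _    = ≤-refl
    𝟙-cross false true  true  false _     _    = z≤n
    𝟙-cross false false _     _     _     _    = z≤n

  edgesIn≤count² : ∀ U → edgesIn G U ≤ count U * count U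
  edgesIn≤count² U = begin
    edgesIn G U                                   ≤⟨ sumF-mono (λ u → sumF-mono (𝟙-orderedEdge≤ u)) ⟩
    sumF (λ u → count (λ w → U u ∧ U w))          ≡⟨ sumF-cong (λ u → count-∧ˡ (U u) U) ⟩
    sumF (λ u → if U u then count U else 0)       ≡⟨ sumF-if-const U (count U) ⟩
    count U * count U                             ∎
    where
    open ≤-Reasoning
    𝟙-orderedEdge≤ : ∀ u w → 𝟙 (orderedEdge U u w) ≤ 𝟙 (U u ∧ U w)
    𝟙-orderedEdge≤ u w with U u | U w
    ... | true  | true  = 𝟙≤1 _
    ... | true  | false = z≤n
    ... | false | _     = z≤n

  edgesIn≤arboricity*count : ∀ {lam} → ArboricityAtMost G lam → 1 ≤ lam →
    ∀ U → edgesIn G U ≤ lam * count U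
  edgesIn≤arboricity*count {lam} arb 1≤lam U with count U in #U
  ... | zero        = ≤-trans (subst (λ c → edgesIn G U ≤ c * c) #U (edgesIn≤count² U)) z≤n
  ... | suc zero    = ≤-trans (subst (λ c → edgesIn G U ≤ c * c) #U (edgesIn≤count² U))
                              (*-monoˡ-≤ 1 1≤lam)
  ... | suc (suc b) = ≤-trans (ceilDiv≤⇒≤* (edgesIn G U) b lam ⌈E/|U|-1⌉≤lam) (*-monoʳ-≤ lam (n≤1+n _))
    where
    ⌈E/|U|-1⌉≤lam : ceilDiv (edgesIn G U) (suc b) ≤ lam
    ⌈E/|U|-1⌉≤lam = subst (λ c → ceilDiv (edgesIn G U) (c ∸ 1) ≤ lam) #U
                      (arb U (subst (2 ≤_) (sym #U) (s≤s (s≤s z≤n))))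

  deg-update : ∀ (H : Graph n) a b → (∀ x y → ¬ SameUnorderedPair x y a b → adj H x y ≡ adj G x y) →
    ∀ x → deg H x ≤ deg G x + 𝟙 (does (x ≟ a)) + 𝟙 (does (x ≟ b))
  deg-update H a b unchanged x with x ≟ a | x ≟ b
  ... | yes refl | _ = ≤-trans
    (count-agreeExcept (adj H x) (adj G x) b (λ y y≢b → unchanged x y λ
      { (inj₁ (_ , y≡b))   → y≢b y≡b
      ; (inj₂ (a≡b , y≡a)) → y≢b (trans y≡a a≡b) }))
    (≤-trans (≤-reflexive (+-comm 1 _)) (m≤m+n _ _))
  ... | no x≢a | yes refl = ≤-trans
    (count-agreeExcept (adj H x) (adj G x) a (λ y y≢a → unchanged x y λ
      { (inj₁ (b≡a , y≡b)) → y≢a (trans y≡b b≡a)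
      ; (inj₂ (_ , y≡a))   → y≢a y≡a }))
    (≤-reflexive (trans (+-comm 1 _) (cong (_+ 1) (sym (+-identityʳ _)))))
  ... | no x≢a | no x≢b = ≤-reflexive (trans
    (sumF-cong (λ y → cong 𝟙 (unchanged x y λ
      { (inj₁ (x≡a , _)) → x≢a x≡a
      ; (inj₂ (x≡b , _)) → x≢b x≡b })))
    (sym (trans (+-identityʳ _) (+-identityʳ _))))

-- Sums along an injective map

InjectiveOn : ∀ {n} → (Fin n → Bool) → (Fin n → Fin n) → Set
InjectiveOn V f = ∀ v w → V v ≡ true → V w ≡ true → f v ≡ f w → v ≡ w

≟-true⇒≡ : ∀ {n} {x y : Fin n} → does (x ≟ y) ≡ true → x ≡ y
≟-true⇒≡ {x = x} {y} eq with x ≟ y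
... | yes x≡y = x≡y

sumF-pick : ∀ {n} (x : Fin n) (g : Fin n → ℕ) → sumF (λ u → if does (x ≟ u) then g u else 0) ≡ g x
sumF-pick {suc n} zero    g = trans (cong (g zero +_) (sumF-zero {n} (λ _ → refl))) (+-identityʳ _)
sumF-pick {suc n} (suc x) g = sumF-pick {n} x (g ∘ suc)

module _ {n} (V : Fin n → Bool) (f : Fin n → Fin n) where

  fiber : Fin n → Fin n → Bool
  fiber u v = V v ∧ does (f v ≟ u)

  image : Fin n → Bool
  image u = anyF (fiber u)

  sumF∘f≡sumF-fibers : ∀ g →
    sumF (λ v → if V v then g (f v) else 0) ≡ sumF (λ u → g u * count (fiber u))
  sumF∘f≡sumF-fibers g = begin
    sumF (λ v → if V v then g (f v) else 0)
      ≡⟨ sumF-cong split ⟩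
    sumF (λ v → sumF (λ u → if fiber u v then g u else 0))
      ≡⟨ sumF-comm (λ v u → if fiber u v then g u else 0) ⟩
    sumF (λ u → sumF (λ v → if fiber u v then g u else 0))
      ≡⟨ sumF-cong (λ u → sumF-if-const (fiber u) (g u)) ⟩
    sumF (λ u → g u * count (fiber u))
      ∎
    where
    open ≡-Reasoning
    split : ∀ v → (if V v then g (f v) else 0) ≡ sumF (λ u → if fiber u v then g u else 0)
    split v with V v
    ... | true  = sym (sumF-pick (f v) g)
    ... | false = sym (sumF-zero {n} (λ _ → refl))

  count-image≤count : count image ≤ count V
  count-image≤count = begin
    count image                                ≤⟨ sumF-mono {n} (λ u → 𝟙-anyF≤count (fiber u)) ⟩
    sumF (λ u → count (fiber u))               ≡⟨ sumF-cong {n} (λ u → sym (*-identityˡ _)) ⟩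
    sumF (λ u → 1 * count (fiber u))           ≡⟨ sym (sumF∘f≡sumF-fibers (λ _ → 1)) ⟩
    count V                                    ∎
    where open ≤-Reasoning

  image⇒∃ : ∀ u → image u ≡ true → ∃ λ v → V v ≡ true × f v ≡ u
  image⇒∃ u image-u with anyF-witness (fiber u) image-u
  ... | v , fiber-u-v with ∧-true⁻ {V v} fiber-u-v
  ...   | Vv , fv≟u = v , Vv , ≟-true⇒≡ fv≟u

  degreeSum : Graph n → ℕ
  degreeSum H = sumF (λ v → if V v then deg H (f v) else 0)

  degreeSum-cong : ∀ {G H} → (∀ x y → adj H x y ≡ adj G x y) → degreeSum H ≡ degreeSum G
  degreeSum-cong H≈G =
    sumF-cong λ v → cong (λ d → if V v then d else 0) (sumF-cong (λ y → cong 𝟙 (H≈G (f v) y)))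

  module _ (inj : InjectiveOn V f) where

    count-fiber≤1 : ∀ u → count (fiber u) ≤ 1
    count-fiber≤1 u = count≤1 (fiber u) λ v w fiber-v fiber-w →
      let Vv , fv≡u = ∧-true⁻ {V v} fiber-v
          Vw , fw≡u = ∧-true⁻ {V w} fiber-w
      in inj v w Vv Vw (trans (≟-true⇒≡ fv≡u) (sym (≟-true⇒≡ fw≡u)))

    sumF∘f≤sumF-image : ∀ g →
      sumF (λ v → if V v then g (f v) else 0) ≤ sumF (λ u → if image u then g u else 0)
    sumF∘f≤sumF-image g = begin
      sumF (λ v → if V v then g (f v) else 0)   ≡⟨ sumF∘f≡sumF-fibers g ⟩
      sumF (λ u → g u * count (fiber u))        ≤⟨ sumF-mono (λ u → *-monoʳ-≤ (g u)
                                                     (count≤𝟙-anyF (fiber u) (count-fiber≤1 u))) ⟩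
      sumF (λ u → g u * 𝟙 (image u))            ≡⟨ sumF-cong (λ u → *-𝟙 (g u) (image u)) ⟩
      sumF (λ u → if image u then g u else 0)   ∎
      where open ≤-Reasoning

    degreeSum-update : ∀ {G H} → OneEdgeUpdate G H → degreeSum H ≤ degreeSum G + 2
    degreeSum-update {G} {H} (a , b , _ , _ , unchanged) = begin
      degreeSum H
        ≤⟨ sumF-mono pointwise ⟩
      sumF (λ v → (if V v then deg G (f v) else 0) + 𝟙 (fiber a v) + 𝟙 (fiber b v))
        ≡⟨ trans (sumF-+ (λ v → (if V v then deg G (f v) else 0) + 𝟙 (fiber a v)) (𝟙 ∘ fiber b))
                 (cong (_+ count (fiber b)) (sumF-+ (λ v → if V v then deg G (f v) else 0) (𝟙 ∘ fiber a))) ⟩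
      degreeSum G + count (fiber a) + count (fiber b)
        ≤⟨ +-mono-≤ (+-monoʳ-≤ (degreeSum G) (count-fiber≤1 a)) (count-fiber≤1 b) ⟩
      degreeSum G + 1 + 1
        ≡⟨ +-assoc (degreeSum G) 1 1 ⟩
      degreeSum G + 2
        ∎
      where
      open ≤-Reasoning
      pointwise : ∀ v → (if V v then deg H (f v) else 0)
                      ≤ (if V v then deg G (f v) else 0) + 𝟙 (fiber a v) + 𝟙 (fiber b v)
      pointwise v with V v
      ... | true  = deg-update G H a b unchanged (f v)
      ... | false = z≤n

    degreeSum-updates : ∀ {G} (Gs : ℕ → Graph n) → (∀ x y → adj (Gs 0) x y ≡ adj G x y) →
      ∀ t → (∀ j → j < t → OneEdgeUpdate (Gs j) (Gs (suc j))) → degreeSum (Gs t) ≤ degreeSum G + 2 * t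
    degreeSum-updates {G} Gs Gs₀≈G zero    _   =
      ≤-trans (≤-reflexive (degreeSum-cong {G} {Gs 0} Gs₀≈G)) (m≤m+n _ _)
    degreeSum-updates {G} Gs Gs₀≈G (suc t) upd = begin
      degreeSum (Gs (suc t))      ≤⟨ degreeSum-update {Gs t} {Gs (suc t)} (upd t ≤-refl) ⟩
      degreeSum (Gs t) + 2        ≤⟨ +-monoˡ-≤ 2 (degreeSum-updates {G} Gs Gs₀≈G t
                                                     (λ j j<t → upd j (m<n⇒m<1+n j<t))) ⟩
      degreeSum G + 2 * t + 2     ≡⟨ +-assoc (degreeSum G) (2 * t) 2 ⟩
      degreeSum G + (2 * t + 2)   ≡⟨ cong (degreeSum G +_) (trans (+-comm (2 * t) 2) (sym (*-suc 2 t))) ⟩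
      degreeSum G + 2 * suc t     ∎
      where open ≤-Reasoning

-- Inequalities x √N ≤ y, compared on squares

*-self-cancel-≤ : ∀ {a b} → a * a ≤ b * b → a ≤ b
*-self-cancel-≤ a²≤b² = ≮⇒≥ (λ b<a → <⇒≱ (*-mono-< b<a b<a) a²≤b²)

infix 4 _·√_≤_

record _·√_≤_ (x N y : ℕ) : Set where
  constructor fromSquares
  field toSquares : x * x * N ≤ y * y

open _·√_≤_ public

module _ {N : ℕ} where

  ·√≤-mono : ∀ {x x′ y y′} → x′ ≤ x → y ≤ y′ → x ·√ N ≤ y → x′ ·√ N ≤ y′
  ·√≤-mono x′≤x y≤y′ (fromSquares x√N≤y) =
    fromSquares (≤-trans (*-monoˡ-≤ N (*-mono-≤ x′≤x x′≤x)) (≤-trans x√N≤y (*-mono-≤ y≤y′ y≤y′)))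

  -- The cross term x x′ N ≤ y y′ is the square root of the product of the two hypotheses.
  ·√≤-+ : ∀ {x y x′ y′} → x ·√ N ≤ y → x′ ·√ N ≤ y′ → x + x′ ·√ N ≤ y + y′
  ·√≤-+ {x} {y} {x′} {y′} (fromSquares x√N≤y) (fromSquares x′√N≤y′) = fromSquares (begin
    (x + x′) * (x + x′) * N
      ≡⟨ solve (x ∷ x′ ∷ N ∷ []) ⟩
    x * x * N + 2 * (x * x′ * N) + x′ * x′ * N
      ≤⟨ +-mono-≤ (+-mono-≤ x√N≤y (*-monoʳ-≤ 2 cross)) x′√N≤y′ ⟩
    y * y + 2 * (y * y′) + y′ * y′
      ≡⟨ solve (y ∷ y′ ∷ []) ⟩
    (y + y′) * (y + y′)
      ∎)
    where
    open ≤-Reasoning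
    cross : x * x′ * N ≤ y * y′
    cross = *-self-cancel-≤ (begin
      x * x′ * N * (x * x′ * N)        ≡⟨ solve (x ∷ x′ ∷ N ∷ []) ⟩
      x * x * N * (x′ * x′ * N)        ≤⟨ *-mono-≤ x√N≤y x′√N≤y′ ⟩
      y * y * (y′ * y′)                ≡⟨ solve (y ∷ y′ ∷ []) ⟩
      y * y′ * (y * y′)                ∎)

  ·√≤-*ˡ : ∀ c {x y} → x ·√ N ≤ y → c * x ·√ N ≤ c * y
  ·√≤-*ˡ c {x} {y} (fromSquares x√N≤y) = fromSquares (begin
    c * x * (c * x) * N    ≡⟨ solve (c ∷ x ∷ N ∷ []) ⟩
    c * c * (x * x * N)    ≤⟨ *-monoʳ-≤ (c * c) x√N≤y ⟩
    c * c * (y * y)        ≡⟨ solve (c ∷ y ∷ []) ⟩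
    c * y * (c * y)        ∎)
    where open ≤-Reasoning

  ·√≤-*ˡ-cancel : ∀ k .{{_ : NonZero k}} {x y} → k * x ·√ N ≤ k * y → x ·√ N ≤ y
  ·√≤-*ˡ-cancel k {x} {y} (fromSquares kx√N≤ky) = fromSquares (*-cancelˡ-≤ (k * k) {{m*n≢0 k k}} (begin
    k * k * (x * x * N)    ≡⟨ solve (k ∷ x ∷ N ∷ []) ⟩
    k * x * (k * x) * N    ≤⟨ kx√N≤ky ⟩
    k * y * (k * y)        ≡⟨ solve (k ∷ y ∷ []) ⟩
    k * k * (y * y)        ∎))
    where open ≤-Reasoning

  ·√≤-sumF : ∀ {n} {f g : Fin n → ℕ} → (∀ i → f i ·√ N ≤ g i) → sumF f ·√ N ≤ sumF g
  ·√≤-sumF {zero}  _     = fromSquares z≤n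
  ·√≤-sumF {suc n} f√N≤g = ·√≤-+ (f√N≤g zero) (·√≤-sumF (f√N≤g ∘ suc))

2t·√N≤2N+Q : ∀ {N Q t} → t * t ≤ N + Q → 2 * t ·√ N ≤ 2 * N + Q
2t·√N≤2N+Q {N} {Q} {t} t²≤N+Q = fromSquares (begin
  2 * t * (2 * t) * N          ≡⟨ solve (t ∷ N ∷ []) ⟩
  4 * (t * t) * N              ≤⟨ *-monoˡ-≤ N (*-monoʳ-≤ 4 t²≤N+Q) ⟩
  4 * (N + Q) * N              ≤⟨ m≤m+n _ (Q * Q) ⟩
  4 * (N + Q) * N + Q * Q      ≡⟨ solve (N ∷ Q ∷ []) ⟩
  (2 * N + Q) * (2 * N + Q)    ∎)
  where open ≤-Reasoning

S²≤16N : ∀ {N Q S D t X} → 1 ≤ N → 2 * D ·√ N ≤ X → t * t ≤ N + Q → S ≤ D + 2 * t →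
  X + 2 * Q ≤ 4 * N → S * S ≤ 16 * N
S²≤16N {N} {Q} {S} {D} {t} {X} 1≤N 2D·√N≤X t²≤N+Q S≤D+2t X+2Q≤4N =
  *-cancelˡ-≤ (4 * N) {{>-nonZero (≤-trans (s≤s z≤n) (*-monoʳ-≤ 4 1≤N))}} (begin
    4 * N * (S * S)        ≡⟨ solve (N ∷ S ∷ []) ⟩
    2 * S * (2 * S) * N    ≤⟨ toSquares 2S·√N≤8N ⟩
    8 * N * (8 * N)        ≡⟨ solve (N ∷ []) ⟩
    4 * N * (16 * N)       ∎)
  where
  open ≤-Reasoning
  2S≤2D+2[2t] : 2 * S ≤ 2 * D + 2 * (2 * t)
  2S≤2D+2[2t] = ≤-trans (*-monoʳ-≤ 2 S≤D+2t) (≤-reflexive (*-distribˡ-+ 2 D (2 * t)))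
  X+2[2N+Q]≤8N : X + 2 * (2 * N + Q) ≤ 8 * N
  X+2[2N+Q]≤8N = begin
    X + 2 * (2 * N + Q)    ≡⟨ solve (X ∷ N ∷ Q ∷ []) ⟩
    X + 2 * Q + 4 * N      ≤⟨ +-monoˡ-≤ (4 * N) X+2Q≤4N ⟩
    4 * N + 4 * N          ≡⟨ solve (N ∷ []) ⟩
    8 * N                  ∎
  2S·√N≤8N : 2 * S ·√ N ≤ 8 * N
  2S·√N≤8N = ·√≤-mono 2S≤2D+2[2t] X+2[2N+Q]≤8N (·√≤-+ 2D·√N≤X (·√≤-*ˡ 2 (2t·√N≤2N+Q {N} {Q} {t} t²≤N+Q)))

-- The candidate inequality d/c ≤ p = a/B ≤ m/(kT), with denominators cleared.
cross-multiplied⇒·√≤ : ∀ {m lam l d k c a B} .{{_ : NonZero B}} → d * B ≤ a * c →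
  l * (a * a * k * k * m * lam) ≤ B * B * m * m → k * d ·√ (m * lam * l) ≤ m * c
cross-multiplied⇒·√≤ {m} {lam} {l} {d} {k} {c} {a} {B} dB≤ac threshold =
  fromSquares (*-cancelʳ-≤ _ _ (B * B) {{m*n≢0 B B}} (begin
    k * d * (k * d) * (m * lam * l) * (B * B)     ≡⟨ solve (d ∷ k ∷ m ∷ lam ∷ l ∷ B ∷ []) ⟩
    d * B * (d * B) * (k * k * m * lam * l)       ≤⟨ *-monoˡ-≤ _ (*-mono-≤ dB≤ac dB≤ac) ⟩
    a * c * (a * c) * (k * k * m * lam * l)       ≡⟨ solve (a ∷ c ∷ k ∷ m ∷ lam ∷ l ∷ []) ⟩
    c * c * (l * (a * a * k * k * m * lam))       ≤⟨ *-monoʳ-≤ (c * c) threshold ⟩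
    c * c * (B * B * m * m)                       ≡⟨ solve (c ∷ B ∷ m ∷ []) ⟩
    m * c * (m * c) * (B * B)                     ∎))
  where open ≤-Reasoning

-- Logarithms and halving rounds

n<2^n : ∀ n → n < 2 ^ n
n<2^n zero    = s≤s z≤n
n<2^n (suc n) = begin-strict
  suc n                 <⟨ s≤s (n<2^n n) ⟩
  suc (2 ^ n)           ≡⟨ +-comm 1 (2 ^ n) ⟩
  2 ^ n + 1             ≤⟨ +-monoʳ-≤ (2 ^ n) (m^n>0 2 n) ⟩
  2 ^ n + 2 ^ n         ≡⟨ cong (2 ^ n +_) (sym (+-identityʳ _)) ⟩
  2 ^ suc n             ∎
  where open ≤-Reasoning

2^-cancel-≤ : ∀ {a b} → 2 ^ a ≤ 2 ^ b → a ≤ b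
2^-cancel-≤ 2^a≤2^b = ≮⇒≥ (λ b<a → <⇒≱ (^-monoʳ-< 2 (s≤s (s≤s z≤n)) b<a) 2^a≤2^b)

log₂-bracket : ∀ m → 1 ≤ m → ∃ λ l → 2 ^ l ≤ m × m < 2 ^ suc l
log₂-bracket m 1≤m = search m (n<2^n m)
  where
  search : ∀ k → m < 2 ^ k → ∃ λ l → 2 ^ l ≤ m × m < 2 ^ suc l
  search zero    m<1 = contradiction 1≤m (<⇒≱ m<1)
  search (suc k) m<2^k+1 with m <? 2 ^ k
  ... | yes m<2^k = search k m<2^k
  ... | no  m≮2^k = k , ≮⇒≥ m≮2^k , m<2^k+1

module Log₂Bracket {m l : ℕ} (2^l≤m : 2 ^ l ≤ m) (m<2^l+1 : m < 2 ^ suc l) where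

  m^a≤2^b⇒l*a≤b : ∀ a b → m ^ a ≤ 2 ^ b → l * a ≤ b
  m^a≤2^b⇒l*a≤b a b m^a≤2^b = 2^-cancel-≤ (begin
    2 ^ (l * a)    ≡⟨ sym (^-*-assoc 2 l a) ⟩
    (2 ^ l) ^ a    ≤⟨ ^-monoˡ-≤ a 2^l≤m ⟩
    m ^ a          ≤⟨ m^a≤2^b ⟩
    2 ^ b          ∎)
    where open ≤-Reasoning

  2^b≤m^a⇒b≤[1+l]*a : ∀ a b → 2 ^ b ≤ m ^ a → b ≤ suc l * a
  2^b≤m^a⇒b≤[1+l]*a a b 2^b≤m^a = 2^-cancel-≤ (begin
    2 ^ b              ≤⟨ 2^b≤m^a ⟩
    m ^ a              ≤⟨ ^-monoˡ-≤ a (<⇒≤ m<2^l+1) ⟩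
    (2 ^ suc l) ^ a    ≡⟨ ^-*-assoc 2 (suc l) a ⟩
    2 ^ (suc l * a)    ∎)
    where open ≤-Reasoning

  b≤l*a⇒2^b≤m^a : ∀ a b → b ≤ l * a → 2 ^ b ≤ m ^ a
  b≤l*a⇒2^b≤m^a a b b≤l*a = begin
    2 ^ b          ≤⟨ ^-monoʳ-≤ 2 b≤l*a ⟩
    2 ^ (l * a)    ≡⟨ sym (^-*-assoc 2 l a) ⟩
    (2 ^ l) ^ a    ≤⟨ ^-monoˡ-≤ a 2^l≤m ⟩
    m ^ a          ∎
    where open ≤-Reasoning

  ⌈log₂m⌉≤1+l : ⌈log₂ m ⌉ ≤ suc l
  ⌈log₂m⌉≤1+l = ≤-trans (⌈log₂⌉-mono-≤ (<⇒≤ m<2^l+1)) (≤-reflexive (⌈log₂2^n⌉≡n (suc l)))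

halving-step : ∀ k′ ℓ → 2 ^ 𝟙 (k′ + ℓ <ᵇ 2 * ℓ) * (2 * k′ + 1) ≤ 2 * (k′ + ℓ) + 1
halving-step k′ ℓ with k′ + ℓ <ᵇ 2 * ℓ | <ᵇ-reflects-< (k′ + ℓ) (2 * ℓ)
... | false | _ = begin
  1 * (2 * k′ + 1)        ≡⟨ *-identityˡ _ ⟩
  2 * k′ + 1              ≤⟨ +-monoˡ-≤ 1 (*-monoʳ-≤ 2 (m≤m+n k′ ℓ)) ⟩
  2 * (k′ + ℓ) + 1        ∎
  where open ≤-Reasoning
... | true  | ofʸ k<2ℓ = begin
  2 * (2 * k′ + 1)        ≡⟨ solve (k′ ∷ []) ⟩
  2 * k′ + 2 * suc k′     ≤⟨ +-monoʳ-≤ (2 * k′) (*-monoʳ-≤ 2 k′<ℓ) ⟩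
  2 * k′ + 2 * ℓ          ≡⟨ sym (*-distribˡ-+ 2 k′ ℓ) ⟩
  2 * (k′ + ℓ)            ≤⟨ m≤m+n _ 1 ⟩
  2 * (k′ + ℓ) + 1        ∎
  where
  open ≤-Reasoning
  k′<ℓ : k′ < ℓ
  k′<ℓ = +-cancelʳ-< ℓ k′ ℓ (subst (k′ + ℓ <_) (cong (ℓ +_) (+-identityʳ ℓ)) k<2ℓ)

halvings≤log : ∀ r (k ℓ : ℕ → ℕ) → (∀ i → k i ≡ k (suc i) + ℓ i) →
  2 ^ sumF {r} (λ i → 𝟙 (k (toℕ i) <ᵇ 2 * ℓ (toℕ i))) ≤ 2 * k 0 + 1
halvings≤log zero    k ℓ split = m≤n+m 1 (2 * k 0)
halvings≤log (suc r) k ℓ split = begin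
  2 ^ (h₀ + H′)              ≡⟨ ^-distribˡ-+-* 2 h₀ H′ ⟩
  2 ^ h₀ * 2 ^ H′            ≤⟨ *-monoʳ-≤ (2 ^ h₀) (halvings≤log r (k ∘ suc) (ℓ ∘ suc) (split ∘ suc)) ⟩
  2 ^ h₀ * (2 * k 1 + 1)     ≤⟨ subst (λ k₀ → 2 ^ 𝟙 (k₀ <ᵇ 2 * ℓ 0) * (2 * k 1 + 1) ≤ 2 * k₀ + 1)
                                      (sym (split 0)) (halving-step (k 1) (ℓ 0)) ⟩
  2 * k 0 + 1                ∎
  where
  open ≤-Reasoning
  h₀ = 𝟙 (k 0 <ᵇ 2 * ℓ 0)
  H′ = sumF {r} (λ i → 𝟙 (k (suc (toℕ i)) <ᵇ 2 * ℓ (suc (toℕ i))))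

few-halvings : ∀ {H k₀ l m} → 1 ≤ k₀ → 1 ≤ l → 2 ^ H ≤ 2 * k₀ + 1 →
  100 * k₀ * k₀ * l ≤ m → m < 2 ^ suc l → H + 5 ≤ l
few-halvings {H} {k₀} {l} {m} 1≤k₀ 1≤l 2^H≤2k₀+1 100k₀²l≤m m<2^l+1 with H + 5 ≤? l
... | yes H+5≤l = H+5≤l
... | no  H+5≰l = contradiction (*-cancelʳ-< A (100 * l * A) 288 100lAA<288A) (≤⇒≯ 288≤100lA)
  where
  open ≤-Reasoning
  A = 2 ^ H
  9*[2*a*16]≡288*a : ∀ a → 9 * (2 * a * 16) ≡ 288 * a
  9*[2*a*16]≡288*a = solve-∀
  l≤H+4 : l ≤ H + 4
  l≤H+4 = ≤-pred (≤-trans (≰⇒> H+5≰l) (≤-reflexive (+-suc H 4)))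
  A≤3k₀ : A ≤ 3 * k₀
  A≤3k₀ = begin
    A               ≤⟨ 2^H≤2k₀+1 ⟩
    2 * k₀ + 1      ≤⟨ +-monoʳ-≤ (2 * k₀) 1≤k₀ ⟩
    2 * k₀ + k₀     ≡⟨ solve (k₀ ∷ []) ⟩
    3 * k₀          ∎
  100lAA<288A : 100 * l * A * A < 288 * A
  100lAA<288A = begin-strict
    100 * l * A * A                  ≡⟨ *-assoc (100 * l) A A ⟩
    100 * l * (A * A)                ≤⟨ *-monoʳ-≤ (100 * l) (*-mono-≤ A≤3k₀ A≤3k₀) ⟩
    100 * l * (3 * k₀ * (3 * k₀))    ≡⟨ solve (l ∷ k₀ ∷ []) ⟩
    9 * (100 * k₀ * k₀ * l)          ≤⟨ *-monoʳ-≤ 9 100k₀²l≤m ⟩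
    9 * m                            <⟨ *-monoʳ-< 9 m<2^l+1 ⟩
    9 * 2 ^ suc l                    ≤⟨ *-monoʳ-≤ 9 (^-monoʳ-≤ 2 (s≤s l≤H+4)) ⟩
    9 * 2 ^ (suc H + 4)              ≡⟨ cong (9 *_) (^-distribˡ-+-* 2 (suc H) 4) ⟩
    9 * (2 * A * 16)                 ≡⟨ 9*[2*a*16]≡288*a A ⟩
    288 * A                          ∎
  100l<2^l+1 : 100 * l < 2 ^ suc l
  100l<2^l+1 = begin-strict
    100 * l               ≤⟨ *-monoˡ-≤ l (*-monoʳ-≤ 100 (*-mono-≤ 1≤k₀ 1≤k₀)) ⟩
    100 * (k₀ * k₀) * l   ≡⟨ cong (_* l) (sym (*-assoc 100 k₀ k₀)) ⟩
    100 * k₀ * k₀ * l     ≤⟨ 100k₀²l≤m ⟩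
    m                     <⟨ m<2^l+1 ⟩
    2 ^ suc l             ∎
  3≤l : 3 ≤ l
  3≤l = bigEnough l 1≤l 100l<2^l+1
    where
    bigEnough : ∀ l → 1 ≤ l → 100 * l < 2 ^ suc l → 3 ≤ l
    bigEnough 1                   _ 100<4   = contradiction 100<4 (≤⇒≯ (m≤m+n 4 96))
    bigEnough 2                   _ 200<8   = contradiction 200<8 (≤⇒≯ (m≤m+n 8 192))
    bigEnough (suc (suc (suc _))) _ _       = s≤s (s≤s (s≤s z≤n))
  288≤100lA : 288 ≤ 100 * l * A
  288≤100lA = begin
    288              ≤⟨ m≤m+n 288 12 ⟩
    100 * 3          ≤⟨ *-monoʳ-≤ 100 3≤l ⟩
    100 * l          ≤⟨ m≤m*n (100 * l) A {{m^n≢0 2 H}} ⟩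
    100 * l * A      ∎

2[ℓ+k]≤[3+halving]*k : ∀ {ℓ k} → ℓ ≤ k → 2 * (ℓ + k) ≤ (3 + 𝟙 (k <ᵇ 2 * ℓ)) * k
2[ℓ+k]≤[3+halving]*k {ℓ} {k} ℓ≤k with k <ᵇ 2 * ℓ | <ᵇ-reflects-< k (2 * ℓ)
... | true  | _         = begin
  2 * (ℓ + k)        ≤⟨ *-monoʳ-≤ 2 (+-monoˡ-≤ k ℓ≤k) ⟩
  2 * (k + k)        ≡⟨ solve (k ∷ []) ⟩
  4 * k              ∎
  where open ≤-Reasoning
... | false | ofⁿ k≮2ℓ = begin
  2 * (ℓ + k)        ≡⟨ *-distribˡ-+ 2 ℓ k ⟩
  2 * ℓ + 2 * k      ≤⟨ +-monoˡ-≤ (2 * k) (≮⇒≥ k≮2ℓ) ⟩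
  k + 2 * k          ≡⟨ solve (k ∷ []) ⟩
  3 * k              ∎
  where open ≤-Reasoning

frac≤⇒cross : ∀ d c {p} → frac d (suc c) ℚ.≤ p → ℤ.+ d ℤ.* ↧ p ℤ.≤ ↥ p ℤ.* ℤ.+ suc c
frac≤⇒cross d c {p} q≤p = begin
  ℤ.+ d ℤ.* ↧ p          ≡⟨ cong (ℤ._* ↧ p) (sym (ℚP.↥-/ (ℤ.+ d) (suc c))) ⟩
  ↥ q ℤ.* g ℤ.* ↧ p    ≡⟨ xy∙z≈xz∙y (↥ q) g (↧ p) ⟩
  ↥ q ℤ.* ↧ p ℤ.* g    ≤⟨ ℤP.*-monoʳ-≤-nonNeg g (ℚP.drop-*≤* q≤p) ⟩
  ↥ p ℤ.* ↧ q ℤ.* g    ≡⟨ ℤP.*-assoc (↥ p) (↧ q) g ⟩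
  ↥ p ℤ.* (↧ q ℤ.* g)  ≡⟨ cong (↥ p ℤ.*_) (ℚP.↧-/ (ℤ.+ d) (suc c)) ⟩
  ↥ p ℤ.* ℤ.+ suc c      ∎
  where
  open ℤP.≤-Reasoning
  q = frac d (suc c)
  g = gcd (ℤ.+ d) (ℤ.+ suc c)

frac≤⇒pos×cross : ∀ {d c p} → 1 ≤ d → frac d (suc c) ℚ.≤ p →
  (p ℚ.≤ᵇ 0ℚ) ≡ false × d * ↧ₙ p ≤ ∣ ↥ p ∣ * suc c
frac≤⇒pos×cross {d} {c} {p} 1≤d q≤p with ↥ p | frac≤⇒cross d c q≤p
... | ℤ.+ zero    | d↧p≤0 = contradiction (ℤP.drop‿+≤+ (subst (ℤ._≤ ℤ.+ 0) (sym (ℤP.pos-* d (↧ₙ p))) d↧p≤0))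
                                        (<⇒≱ (*-mono-≤ 1≤d (s≤s z≤n)))
... | ℤ.+ suc a   | d↧p≤a*c = refl , ℤP.drop‿+≤+
  (subst₂ ℤ._≤_ (sym (ℤP.pos-* d (↧ₙ p))) (sym (ℤP.pos-* (suc a) (suc c))) d↧p≤a*c)
... | -[1+ a ]    | d↧p≤-   = contradiction
  (subst (ℤ._≤ -[1+ a ] ℤ.* ℤ.+ suc c) (sym (ℤP.pos-* d (↧ₙ p))) d↧p≤-) λ ()

-- The candidate procedure

module ProcedureProperties {n} (G : Graph n) (lam : ℕ) (med : ℕ → Fin n → ℚ) where

  open Procedure G lam med

  L⇒K : ∀ i {v} → L i v ≡ true → K i v ≡ true
  L⇒K i = proj₁ ∘ ∧-true⁻

  K-antitone : ∀ {i j v} → i ≤ j → K j v ≡ true → K i v ≡ true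
  K-antitone = antitone′ ∘ ≤⇒≤′
    where
    antitone′ : ∀ {i j v} → i ≤′ j → K j v ≡ true → K i v ≡ true
    antitone′ ≤′-refl         Kjv = Kjv
    antitone′ (≤′-step i≤′j) Kjv = antitone′ i≤′j (proj₁ (∧-true⁻ Kjv))

  K⇒Vhigh : ∀ i {v} → K i v ≡ true → Vhigh v ≡ true
  K⇒Vhigh i = K-antitone {j = i} z≤n

  L⇒Vhigh : ∀ i {v} → L i v ≡ true → Vhigh v ≡ true
  L⇒Vhigh i = K⇒Vhigh i ∘ L⇒K i

  L⇒¬K-later : ∀ {i j v} → L i v ≡ true → i < j → K j v ≡ false
  L⇒¬K-later {i} {j} {v} Liv i<j with K j v in Kjv
  ... | false = refl
  ... | true  = contradiction
    (subst (λ b → not b ≡ true) Liv (proj₂ (∧-true⁻ {K i v} (K-antitone i<j Kjv)))) λ ()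

  L-unique : ∀ {i j v} → L i v ≡ true → L j v ≡ true → i ≡ j
  L-unique {i} {j} Liv Ljv with <-cmp i j
  ... | tri< i<j _ _ = contradiction (trans (sym (L⇒K j Ljv)) (L⇒¬K-later Liv i<j)) λ ()
  ... | tri≈ _ i≡j _ = i≡j
  ... | tri> _ _ j<i = contradiction (trans (sym (L⇒K i Liv)) (L⇒¬K-later Ljv j<i)) λ ()

  count-K-step : ∀ i → count (K i) ≡ count (K (suc i)) + count (L i)
  count-K-step i = count-remove (K i) (L i) (λ _ → L⇒K i)

  Astar⇒low : ∀ {u} → Astar u ≡ true → Vhigh u ≡ false
  Astar⇒low {u} A*u with Vhigh u
  ... | false = refl

  module _ (f : Fin n → Fin n) (cand : ∀ v → Vhigh v ≡ true → Candidate v (f v)) where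

    candidate∈A* : ∀ v → Vhigh v ≡ true → Astar (f v) ≡ true
    candidate∈A* v high = let (_ , _ , _ , _ , A*fv , _) = cand v high in A*fv

    all-high⇒none-high : (∀ v → Vhigh v ≡ true) → ∀ v → Vhigh v ≡ false
    all-high⇒none-high all-high v =
      contradiction (trans (sym (all-high (f v))) (Astar⇒low (candidate∈A* v (all-high v)))) λ ()

  trivial-threshold⇒all-high : m ^ (400 * m * lam) ≡ 1 → ∀ v → Vhigh v ≡ true
  trivial-threshold⇒all-high m^[400*m*lam]≡1 v = Equivalence.to T-≡
    (subst (λ x → T (x ≤ᵇ 2 ^ (deg G v * deg G v))) (sym m^[400*m*lam]≡1)
           (≤⇒≤ᵇ (m^n>0 2 (deg G v * deg G v))))

  none-high⇒degreeSum≤c·T : 1 ≤ m → (∀ v → Vhigh v ≡ false) → ∀ f H c → degreeSum Vhigh f H ≤ c ·T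
  none-high⇒degreeSum≤c·T 1≤m none-high f H c =
    subst (λ s → 2 ^ (s * s) ≤ m ^ (c * c * m * lam))
          (sym (sumF-zero (λ v → cong (λ b → if b then deg H (f v) else 0) (none-high v))))
          (m^n>0 m {{>-nonZero 1≤m}} (c * c * m * lam))

  module Bounds (l : ℕ) (2^l≤m : 2 ^ l ≤ m) (m<2^l+1 : m < 2 ^ suc l) where

    open Log₂Bracket {m} {l} 2^l≤m m<2^l+1

    N : ℕ
    N = m * lam * l

    high⇒20·√N≤deg : ∀ {v} → Vhigh v ≡ true → 20 ·√ N ≤ deg G v
    high⇒20·√N≤deg {v} high = fromSquares (begin
      20 * 20 * (m * lam * l)    ≡⟨ rearrange m lam l ⟩
      l * (400 * m * lam)        ≤⟨ m^a≤2^b⇒l*a≤b _ _ (≤ᵇ-true⇒≤ high) ⟩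
      deg G v * deg G v          ∎)
      where
      open ≤-Reasoning
      rearrange : ∀ m lam l → 20 * 20 * (m * lam * l) ≡ l * (400 * m * lam)
      rearrange = solve-∀

    candidate-bound : ∀ {i v u} → L i v ≡ true → adj G v u ≡ true → unitcost i u ℚ.≤ med i v →
      count (K i) * deg G u ·√ N ≤ m * count (λ w → adj G u w ∧ K i w)
    candidate-bound {i} {v} {u} Liv vu cost≤p with count (λ w → adj G u w ∧ K i w) in #N[u]∩K
    ... | zero  = contradiction (subst (1 ≤_) #N[u]∩K (count-pos _ v (cong₂ _∧_ uv (L⇒K i Liv)))) λ ()
      where uv = trans (Graph.sym G u v) vu
    ... | suc c = cross-multiplied⇒·√≤ {m} {lam} {l} {deg G u} {count (K i)} {suc c} {∣ ↥ p ∣} {↧ₙ p}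
                    ↧p-bound (m^a≤2^b⇒l*a≤b _ _ (≤ᵇ-true⇒≤ threshold))
      where
      p = med i v
      uv = trans (Graph.sym G u v) vu
      p≰0 = proj₁ (frac≤⇒pos×cross (count-pos (adj G u) v uv) cost≤p)
      ↧p-bound = proj₂ (frac≤⇒pos×cross (count-pos (adj G u) v uv) cost≤p)
      a = ∣ ↥ p ∣
      k = count (K i)
      threshold : (m ^ (a * a * k * k * m * lam) ≤ᵇ 2 ^ (↧ₙ p * ↧ₙ p * m * m)) ≡ true
      threshold = subst (λ b → b ∨ (m ^ (a * a * k * k * m * lam) ≤ᵇ 2 ^ (↧ₙ p * ↧ₙ p * m * m)) ≡ true)
                        p≰0 (proj₂ (∧-true⁻ {K i v} Liv))

    module Matching (f : Fin n → Fin n) (inj : InjectiveOn Vhigh f)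
               (cand : ∀ v → Vhigh v ≡ true → Candidate v (f v))
               (arb : ArboricityAtMost G lam) (1≤lam : 1 ≤ lam) where

      k ℓ : ℕ → ℕ
      k i = count (K i)
      ℓ i = count (L i)

      D : ℕ → ℕ
      D i = sumF (λ v → if L i v then deg G (f v) else 0)

      E : ℕ → ℕ
      E i = sumF (λ v → if L i v then count (λ w → adj G (f v) w ∧ K i w) else 0)

      halving : ℕ → ℕ
      halving i = 𝟙 (k i <ᵇ 2 * ℓ i)

      kD·√N≤mE : ∀ i → k i * D i ·√ N ≤ m * E i
      kD·√N≤mE i = subst₂ (_·√ N ≤_)
        (sumF-*ˡ (k i) (λ v → if L i v then deg G (f v) else 0))
        (sumF-*ˡ m (λ v → if L i v then count (λ w → adj G (f v) w ∧ K i w) else 0))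
        (·√≤-sumF pointwise)
        where
        pointwise : ∀ v → k i * (if L i v then deg G (f v) else 0)
                          ·√ N ≤ m * (if L i v then count (λ w → adj G (f v) w ∧ K i w) else 0)
        pointwise v with L i v in Liv
        ... | false = subst (_·√ N ≤ m * 0) (sym (*-zeroʳ (k i))) (fromSquares z≤n)
        ... | true with cand v (L⇒Vhigh i Liv)
        ...   | (j , _ , Ljv , v~fv , _ , cost≤p) with L-unique Liv Ljv
        ...     | refl = candidate-bound Ljv v~fv cost≤p

      E≤lam[ℓ+k] : ∀ i → E i ≤ lam * (ℓ i + k i)
      E≤lam[ℓ+k] i = begin
        E i                                   ≤⟨ sumF∘f≤sumF-image (L i) f injL _ ⟩
        sumF (λ u → if image (L i) f u then count (λ w → adj G u w ∧ K i w) else 0)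
                                              ≤⟨ crossEdges≤edgesIn G (image (L i) f) (K i) image∩K≡∅ ⟩
        edgesIn G (λ x → image (L i) f x ∨ K i x)
                                              ≤⟨ edgesIn≤arboricity*count G arb 1≤lam _ ⟩
        lam * count (λ x → image (L i) f x ∨ K i x)
                                              ≤⟨ *-monoʳ-≤ lam (count-∨ (image (L i) f) (K i)) ⟩
        lam * (count (image (L i) f) + k i)   ≤⟨ *-monoʳ-≤ lam (+-monoˡ-≤ _ (count-image≤count (L i) f)) ⟩
        lam * (ℓ i + k i)                     ∎
        where
        open ≤-Reasoning
        injL : InjectiveOn (L i) f
        injL v w Liv Liw = inj v w (L⇒Vhigh i Liv) (L⇒Vhigh i Liw)
        image∩K≡∅ : ∀ u → image (L i) f u ≡ true → K i u ≡ false
        image∩K≡∅ u image-u with image⇒∃ (L i) f u image-u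
        ... | v , Liv , refl with K i (f v) in Kfv
        ...   | false = refl
        ...   | true  = contradiction
          (trans (sym (K⇒Vhigh i Kfv)) (Astar⇒low (candidate∈A* f cand v (L⇒Vhigh i Liv)))) λ ()

      2D·√N≤Q[3+halving] : ∀ i → 2 * D i ·√ N ≤ m * lam * (3 + halving i)
      2D·√N≤Q[3+halving] i with k i ℕ.≟ 0
      ... | yes k≡0 = ·√≤-mono (≤-reflexive (cong (2 *_) D≡0)) ≤-refl (fromSquares z≤n)
        where
        D≡0 : D i ≡ 0
        D≡0 = sumF-zero {n} (λ v → cong (λ b → if b ∧ ≤m/[ med i v ·T]ᵇ (k i) then deg G (f v) else 0)
                                        (count≡0⇒false (K i) k≡0 v))
      ... | no  k≢0 = ·√≤-*ˡ-cancel (k i) {{≢-nonZero k≢0}} (·√≤-mono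
        (≤-reflexive (x*[2*y]≡2*[x*y] (k i) (D i)))
        (begin
          2 * (m * E i)                       ≤⟨ *-monoʳ-≤ 2 (*-monoʳ-≤ m (E≤lam[ℓ+k] i)) ⟩
          2 * (m * (lam * (ℓ i + k i)))       ≡⟨ rearrange m lam (ℓ i + k i) ⟩
          m * lam * (2 * (ℓ i + k i))         ≤⟨ *-monoʳ-≤ (m * lam) (2[ℓ+k]≤[3+halving]*k ℓ≤k) ⟩
          m * lam * ((3 + halving i) * k i)   ≡⟨ x*[y*z]≡z*[x*y] (m * lam) (3 + halving i) (k i) ⟩
          k i * (m * lam * (3 + halving i))   ∎)
        (·√≤-*ˡ 2 (kD·√N≤mE i)))
        where
        open ≤-Reasoning
        ℓ≤k : ℓ i ≤ k i
        ℓ≤k = count-mono {P = L i} (λ _ → L⇒K i)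
        x*[2*y]≡2*[x*y] : ∀ x y → x * (2 * y) ≡ 2 * (x * y)
        x*[2*y]≡2*[x*y] = solve-∀
        rearrange : ∀ m lam x → 2 * (m * (lam * x)) ≡ m * lam * (2 * x)
        rearrange = solve-∀
        x*[y*z]≡z*[x*y] : ∀ x y z → x * (y * z) ≡ z * (x * y)
        x*[y*z]≡z*[x*y] = solve-∀

      H : ℕ
      H = sumF {rounds} (λ i → halving (toℕ i))

      high-sum≤ΣD : degreeSum Vhigh f G ≤ sumF {rounds} (λ i → D (toℕ i))
      high-sum≤ΣD = begin
        degreeSum Vhigh f G
          ≤⟨ sumF-mono pointwise ⟩
        sumF (λ v → sumF {rounds} (λ i → if L (toℕ i) v then deg G (f v) else 0))
          ≡⟨ sumF-comm {n} {rounds} (λ v i → if L (toℕ i) v then deg G (f v) else 0) ⟩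
        sumF {rounds} (λ i → D (toℕ i))
          ∎
        where
        open ≤-Reasoning
        pointwise : ∀ v → (if Vhigh v then deg G (f v) else 0)
                        ≤ sumF {rounds} (λ i → if L (toℕ i) v then deg G (f v) else 0)
        pointwise v with Vhigh v in high
        ... | false = z≤n
        ... | true with cand v high
        ...   | i , i<r , Liv , _ = ≤-trans
          (≤-reflexive (cong (λ b → if b then deg G (f v) else 0)
                             (sym (subst (λ j → L j v ≡ true) (sym (toℕ-fromℕ< i<r)) Liv))))
          (term≤sumF (λ j → if L (toℕ j) v then deg G (f v) else 0) (fromℕ< i<r))

      2SG·√N≤Q[3r+H] : 2 * degreeSum Vhigh f G ·√ N ≤ m * lam * (rounds * 3 + H)
      2SG·√N≤Q[3r+H] = ·√≤-mono
        (begin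
          2 * degreeSum Vhigh f G                ≤⟨ *-monoʳ-≤ 2 high-sum≤ΣD ⟩
          2 * sumF {rounds} (λ i → D (toℕ i))    ≡⟨ sym (sumF-*ˡ {rounds} 2 (λ i → D (toℕ i))) ⟩
          sumF {rounds} (λ i → 2 * D (toℕ i))    ∎)
        (≤-reflexive (begin-equality
          sumF {rounds} (λ i → m * lam * (3 + halving (toℕ i)))
            ≡⟨ sumF-*ˡ {rounds} (m * lam) (λ i → 3 + halving (toℕ i)) ⟩
          m * lam * sumF {rounds} (λ i → 3 + halving (toℕ i))
            ≡⟨ cong (m * lam *_) (sumF-+ {rounds} (λ _ → 3) (λ i → halving (toℕ i))) ⟩
          m * lam * (sumF {rounds} (λ _ → 3) + H)
            ≡⟨ cong (λ x → m * lam * (x + H)) (sumF-const rounds 3) ⟩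
          m * lam * (rounds * 3 + H)
            ∎))
        (·√≤-sumF {n = rounds} (λ i → 2D·√N≤Q[3+halving] (toℕ i)))
        where open ≤-Reasoning

      100k₀²l≤m : 100 * k 0 * k 0 * l ≤ m
      100k₀²l≤m = *-cancelˡ-≤ (4 * m) {{>-nonZero (≤-trans (s≤s z≤n) (*-monoʳ-≤ 4 1≤m))}} (begin
        4 * m * (100 * k 0 * k 0 * l)              ≤⟨ *-monoʳ-≤ (4 * m) (m≤m*n _ lam {{>-nonZero 1≤lam}}) ⟩
        4 * m * (100 * k 0 * k 0 * l * lam)        ≡⟨ rearrange m lam l (k 0) ⟩
        20 * k 0 * (20 * k 0) * (m * lam * l)      ≤⟨ toSquares 20k₀·√N≤2m ⟩
        2 * m * (2 * m)                            ≡⟨ [2*x]*[2*x]≡4*x*x m ⟩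
        4 * m * m                                  ∎)
        where
        open ≤-Reasoning
        1≤m = ≤-trans (m^n>0 2 l) 2^l≤m
        rearrange : ∀ m lam l k → 4 * m * (100 * k * k * l * lam) ≡ 20 * k * (20 * k) * (m * lam * l)
        rearrange = solve-∀
        [2*x]*[2*x]≡4*x*x : ∀ x → 2 * x * (2 * x) ≡ 4 * x * x
        [2*x]*[2*x]≡4*x*x = solve-∀
        20k₀·√N≤2m : 20 * k 0 ·√ N ≤ 2 * m
        20k₀·√N≤2m = ·√≤-mono (≤-reflexive (sym (sumF-if-const Vhigh 20)))
          (≤-trans (sumF-mono high-deg≤deg) (≤-reflexive (sum-deg≡2*edges G)))
          (·√≤-sumF pointwise)
          where
          high-deg≤deg : ∀ v → (if Vhigh v then deg G v else 0) ≤ deg G v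
          high-deg≤deg v with Vhigh v
          ... | true  = ≤-refl
          ... | false = z≤n
          pointwise : ∀ v → (if Vhigh v then 20 else 0) ·√ N ≤ (if Vhigh v then deg G v else 0)
          pointwise v with Vhigh v in high
          ... | true  = high⇒20·√N≤deg high
          ... | false = fromSquares z≤n

      degreeSum≤4T : 1 ≤ l → 1 ≤ k 0 → ∀ t → t ≤ 1 ·T → (Gs : ℕ → Graph n) →
        (∀ x y → adj (Gs 0) x y ≡ adj G x y) → (∀ j → j < t → OneEdgeUpdate (Gs j) (Gs (suc j))) →
        degreeSum Vhigh f (Gs t) ≤ 4 ·T
      degreeSum≤4T 1≤l 1≤k₀ t t≤T Gs Gs₀≈G updates = b≤l*a⇒2^b≤m^a (4 * 4 * m * lam) (S * S) (begin
        S * S                     ≤⟨ S²≤16N {D = degreeSum Vhigh f G} {t = t}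
                                       {X = m * lam * (rounds * 3 + H)} 1≤N 2SG·√N≤Q[3r+H] t²≤N+Q
                                       (degreeSum-updates Vhigh f inj {G} Gs Gs₀≈G t updates) X+2Q≤4N ⟩
        16 * N                    ≡⟨ 16*N≡l*[4*4*m*lam] m lam l ⟩
        l * (4 * 4 * m * lam)     ∎)
        where
        open ≤-Reasoning
        16*N≡l*[4*4*m*lam] : ∀ m lam l → 16 * (m * lam * l) ≡ l * (4 * 4 * m * lam)
        16*N≡l*[4*4*m*lam] = solve-∀
        [1+l]*[1*1*m*lam]≡N+Q : ∀ m lam l → suc l * (1 * 1 * m * lam) ≡ m * lam * l + m * lam
        [1+l]*[1*1*m*lam]≡N+Q = solve-∀
        [1+l]*3+H+2≡3l+[H+5] : ∀ l H → suc l * 3 + H + 2 ≡ 3 * l + (H + 5)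
        [1+l]*3+H+2≡3l+[H+5] = solve-∀
        q*x+2*q≡q*[x+2] : ∀ q x → q * x + 2 * q ≡ q * (x + 2)
        q*x+2*q≡q*[x+2] = solve-∀
        q*[4*l]≡4*[q*l] : ∀ q l → q * (4 * l) ≡ 4 * (q * l)
        q*[4*l]≡4*[q*l] = solve-∀
        S = degreeSum Vhigh f (Gs t)
        t²≤N+Q : t * t ≤ N + m * lam
        t²≤N+Q = ≤-trans (2^b≤m^a⇒b≤[1+l]*a (1 * 1 * m * lam) (t * t) t≤T)
                         (≤-reflexive ([1+l]*[1*1*m*lam]≡N+Q m lam l))
        H+5≤l : H + 5 ≤ l
        H+5≤l = few-halvings 1≤k₀ 1≤l (halvings≤log rounds k ℓ count-K-step) 100k₀²l≤m m<2^l+1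
        3r+H+2≤4l : rounds * 3 + H + 2 ≤ 4 * l
        3r+H+2≤4l = begin
          rounds * 3 + H + 2      ≤⟨ +-monoˡ-≤ 2 (+-monoˡ-≤ H (*-monoˡ-≤ 3 ⌈log₂m⌉≤1+l)) ⟩
          suc l * 3 + H + 2       ≡⟨ [1+l]*3+H+2≡3l+[H+5] l H ⟩
          3 * l + (H + 5)         ≤⟨ +-monoʳ-≤ (3 * l) H+5≤l ⟩
          3 * l + l               ≡⟨ +-comm (3 * l) l ⟩
          4 * l                   ∎
        X+2Q≤4N : m * lam * (rounds * 3 + H) + 2 * (m * lam) ≤ 4 * N
        X+2Q≤4N = begin
          m * lam * (rounds * 3 + H) + 2 * (m * lam)   ≡⟨ q*x+2*q≡q*[x+2] (m * lam) (rounds * 3 + H) ⟩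
          m * lam * (rounds * 3 + H + 2)               ≤⟨ *-monoʳ-≤ (m * lam) 3r+H+2≤4l ⟩
          m * lam * (4 * l)                            ≡⟨ q*[4*l]≡4*[q*l] (m * lam) l ⟩
          4 * N                                        ∎
        1≤N : 1 ≤ N
        1≤N = *-mono-≤ (*-mono-≤ (≤-trans (m^n>0 2 l) 2^l≤m) 1≤lam) 1≤l

lemma16 : ∀ {n : ℕ} (G : Graph n) (lam : ℕ) (med : ℕ → Fin n → ℚ)
    → let open Procedure G lam med in
      1 ≤ m
    → (∀ i → i < rounds → ∀ v → K i v ≡ true → IsMedianOfS i v (med i v))
    → (t : ℕ) → t ≤ 1 ·T
    → (Gs : ℕ → Graph n)
    → (∀ x y → adj (Gs 0) x y ≡ adj G x y)
    → (∀ j → j < t → OneEdgeUpdate (Gs j) (Gs (suc j)))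
    → ArboricityAtMost G lam
    → (∀ j → j ≤ t → ArboricityAtMost (Gs j) lam)
    → (f : Fin n → Fin n)
    → (∀ v w → Vhigh v ≡ true → Vhigh w ≡ true → f v ≡ f w → v ≡ w)
    → (∀ v → Vhigh v ≡ true → Candidate v (f v))
    → sumF (λ v → if Vhigh v then deg (Gs t) (f v) else 0) ≤ 4 ·T
lemma16 G lam med 1≤m _ t t≤T Gs Gs₀≈G updates arb _ f inj cand =
  bound (log₂-bracket m 1≤m) (1 ≤? lam) (1 ≤? count Vhigh)
  where
  open Procedure G lam med
  open ProcedureProperties G lam med
  none-high : (∀ v → Vhigh v ≡ false) → degreeSum Vhigh f (Gs t) ≤ 4 ·T
  none-high none = none-high⇒degreeSum≤c·T 1≤m none f (Gs t) 4
  -- When the threshold 20T is 0, A* is empty, so no vertex can be high.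
  all-high : m ^ (400 * m * lam) ≡ 1 → degreeSum Vhigh f (Gs t) ≤ 4 ·T
  all-high = none-high ∘ all-high⇒none-high f cand ∘ trivial-threshold⇒all-high
  bound : (∃ λ l → 2 ^ l ≤ m × m < 2 ^ suc l) → Dec (1 ≤ lam) → Dec (1 ≤ count Vhigh) →
    degreeSum Vhigh f (Gs t) ≤ 4 ·T
  bound (zero , _ , m<2) _ _ = all-high (trans (cong (_^ (400 * m * lam)) m≡1) (^-zeroˡ (400 * m * lam)))
    where m≡1 = ≤-antisym (≤-pred m<2) 1≤m
  bound (suc l , _ , _) (no 1≰lam) _ =
    all-high (cong (m ^_) (trans (cong (400 * m *_) lam≡0) (*-zeroʳ (400 * m))))
    where lam≡0 = n≤0⇒n≡0 (≤-pred (≰⇒> 1≰lam))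
  bound (suc l , _ , _) (yes _) (no 1≰k₀) = none-high (count≡0⇒false Vhigh (n≤0⇒n≡0 (≤-pred (≰⇒> 1≰k₀))))
  bound (suc l , 2^l≤m , m<2^l+1) (yes 1≤lam) (yes 1≤k₀) = Bounds.Matching.degreeSum≤4T
    (suc l) 2^l≤m m<2^l+1 f inj cand arb 1≤lam (s≤s z≤n) 1≤k₀ t t≤T Gs Gs₀≈G updates
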